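{- Let $M$ be a Turing machine and let $\mathcal{H}_M$ be as in the context. Then $\mathcal{H}_M$ has an infinite Littlestone tree if and only if $M$ does not halt on the empty input.
   Context: $\mathbb{N}=\{0,1,2,\dots\}$. Let $c_c(\{0,1\})$ be the set of finitely supported sequences $a:\mathbb{N}\to\{0,1\}$. For a Turing machine $M$ and $a\in c_c(\{0,1\})$, define $h_a:\mathbb{N}\to\{0,1\}$ by $h_a(n)=a(n)$ if $M$ does not halt after $\le n$ steps on the empty input, and $h_a(n)=0$ otherwise; $\mathcal{H}_M=\{h_a: a\in c_c(\{0,1\})\}$. A family $\{x_{\mathbf v}\}_{\mathbf v\in\{0,1\}^k, 0\le k<d}\subseteq\mathbb{N}$ indexed by nodes of a complete binary tree is a Littlestone tree of depth $d\le\infty$ of $\mathcal{G}\subseteq\{0,1\}^{\mathbb{N}}$ if for every $y_1,y_2,\dots\in\{0,1\}$ and every $0\le n<d$ there is $g\in\mathcal{G}$ with $g(x_{y_1\dots y_k})=y_{k+1}$ for all $0\le k\le n$; an infinite Littlestone tree is one of depth $\infty$. -}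

module Defs where

open import Data.Nat using (ℕ; zero; suc; _≤_; _<_)
open import Data.Fin using (Fin; toℕ)
open import Data.Bool using (Bool; true; false; if_then_else_)
open import Data.Maybe using (Maybe; just; nothing; is-nothing)
open import Data.List using (List; []; _∷_)
open import Data.Vec using (Vec; tabulate)
open import Data.Product using (Σ; _×_; _,_; ∃)
open import Relation.Binary.PropositionalEquality using (_≡_)

-- Turing machines (single two-way infinite tape, finite alphabet,
-- symbol 'zero' is the blank; a machine halts when no transition is
-- defined for the current (state, symbol) pair).

data Move : Set where
  L R : Move

record TM : Set where
  field
    Q     : ℕ
    Γ     : ℕ
    start : Fin Q
    δ     : Fin Q → Fin (suc Γ) → Maybe (Fin Q × Fin (suc Γ) × Move)

module _ (M : TM) where
  open TM M

  Sym : Set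
  Sym = Fin (suc Γ)

  blank : Sym
  blank = Fin.zero
    where import Data.Fin as Fin

  -- configuration: state, tape left of head (nearest first), head symbol,
  -- tape right of head (nearest first); omitted cells are blank.
  record Config : Set where
    constructor cfg
    field
      state : Fin Q
      left  : List Sym
      head  : Sym
      right : List Sym

  pop : List Sym → Sym × List Sym
  pop []       = blank , []
  pop (s ∷ ss) = s , ss

  move : Move → List Sym → Sym → List Sym → Sym × List Sym × List Sym
  move L l s r with pop l
  ... | h , l' = h , l' , (s ∷ r)
  move R l s r with pop r
  ... | h , r' = h , (s ∷ l) , r'

  step : Config → Maybe Config
  step (cfg q l s r) with δ q s
  ... | nothing = nothing
  ... | just (q' , s' , d) with move d l s' r
  ...   | h , l' , r' = just (cfg q' l' h r')

  -- run n steps; nothing = halted at some step ≤ n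
  run : ℕ → Config → Maybe Config
  run zero    c = just c
  run (suc n) c with step c
  ... | nothing = nothing
  ... | just c' = run n c'

  initial : Config
  initial = cfg start [] blank []

  haltsWithinᵇ : ℕ → Bool
  haltsWithinᵇ n = is-nothing (run n initial)

  HaltsWithin : ℕ → Set
  HaltsWithin n = haltsWithinᵇ n ≡ true

  Halts : Set
  Halts = ∃ λ n → HaltsWithin n

-- Classes of functions ℕ → {0,1}, as predicates (membership up to
-- pointwise equality, since we lack function extensionality).

Class : Set₁
Class = (ℕ → Bool) → Set

FinSupp : (ℕ → Bool) → Set
FinSupp a = ∃ λ N → ∀ n → N ≤ n → a n ≡ false

h : TM → (ℕ → Bool) → ℕ → Bool
h M a n = if haltsWithinᵇ M n then false else a n

𝓗 : TM → Class
𝓗 M g = Σ (ℕ → Bool) λ a → FinSupp a × (∀ n → g n ≡ h M a n)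

prefix : (ℕ → Bool) → (k : ℕ) → Vec Bool k
prefix y k = tabulate (λ i → y (toℕ i))

-- y₁ y₂ … is represented 0-indexed by y : ℕ → Bool (y k = y_{k+1}).
IsInfiniteLittlestoneTree : Class → ((k : ℕ) → Vec Bool k → ℕ) → Set
IsInfiniteLittlestoneTree G x =
  ∀ (y : ℕ → Bool) (n : ℕ) →
    Σ (ℕ → Bool) λ g → G g × (∀ k → k ≤ n → g (x k (prefix y k)) ≡ y k)

HasInfiniteLittlestoneTree : Class → Set
HasInfiniteLittlestoneTree G =
  Σ ((k : ℕ) → Vec Bool k → ℕ) λ x → IsInfiniteLittlestoneTree G x

-- If M halts within N steps, every member of 𝓗_M vanishes from N on, so all members agree
-- outside the finite set {0, …, N-1}. A class whose members agree outside a finite set F has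
-- no infinite Littlestone tree: the root r must lie in F (else the two labellings of r
-- contradict agreement), and the subtree below the edge labelled false is an infinite tree of
-- the subclass fixed at r, whose members agree outside F ∖ {r}; induct on the size of F.
-- Conversely, if M never halts then h_a = a, and the tree labelling depth k by the point k
-- is shattered by truncations of the path.
module Submission where

open import Defs
open import Data.Product using (_×_)
open import Relation.Nullary using (¬_)

open import Data.Bool using (Bool; true; false; if_then_else_)
open import Data.Bool.Properties using (not-¬; T-≡)
open import Data.Empty using (⊥-elim)
open import Data.Nat using (ℕ; zero; suc; _≤_; _<_; _≟_; _≤ᵇ_; z≤n; s≤s)
open import Data.List using (List; length; filter; upTo)
open import Data.List.Membership.Propositional using (_∈_; _∉_)
open import Data.List.Membership.DecPropositional _≟_ using (_∈?_)
open import Data.List.Membership.Propositional.Properties using (∈-filter⁺; ∈-upTo⁺)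
open import Data.List.Properties using (filter-notAll)
open import Data.List.Relation.Unary.Any as Any using ()
open import Data.Maybe using (just; nothing; is-nothing)
open import Data.Nat.Induction using (<-wellFounded)
open import Data.Nat.Properties using (≤⇒≤ᵇ; ≤ᵇ⇒≤; ≮⇒≥; <⇒≱)
open import Data.Product using (Σ; _,_)
open import Data.Vec using (Vec; []; _∷_)
open import Function.Bundles using (Equivalence)
open import Induction.WellFounded using (Acc; acc)
open import Relation.Binary.PropositionalEquality using (_≡_; _≢_; refl; sym; trans)
open import Relation.Nullary using (yes; no; ¬?)

Tree : Set
Tree = (k : ℕ) → Vec Bool k → ℕ

depthTree : Tree
depthTree k _ = k

root : Tree → ℕ
root x = x 0 []

subtree : Tree → Bool → Tree
subtree x b k v = x (suc k) (b ∷ v)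

Pinned : Class → ℕ → Bool → Class
Pinned G r b g = G g × g r ≡ b

AgreeOutside : Class → List ℕ → Set
AgreeOutside G F = ∀ {g g′} → G g → G g′ → ∀ {p} → p ∉ F → g p ≡ g′ p

infixl 5 _∖_
_∖_ : List ℕ → ℕ → List ℕ
F ∖ r = filter (λ p → ¬? (p ≟ r)) F

subtree-isInfiniteLittlestoneTree : ∀ {G} x b → IsInfiniteLittlestoneTree G x →
  IsInfiniteLittlestoneTree (Pinned G (root x) b) (subtree x b)
-- The path b, y₀, y₁, … has prefix (suc k) ≡ b ∷ prefix y k definitionally.
subtree-isInfiniteLittlestoneTree x b T y n
  with g , Gg , fits ← T (λ { zero → b ; (suc k) → y k }) (suc n)
  = g , (Gg , fits 0 z≤n) , λ k k≤n → fits (suc k) (s≤s k≤n)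

root-labels-disagree : ∀ {G} x → IsInfiniteLittlestoneTree G x →
  Σ (ℕ → Bool) λ g → Σ (ℕ → Bool) λ g′ → G g × G g′ × g (root x) ≢ g′ (root x)
root-labels-disagree x T
  with g , Gg , fits ← T (λ _ → true) 0
     | g′ , Gg′ , fits′ ← T (λ _ → false) 0
  = g , g′ , Gg , Gg′ , λ g≡g′ → not-¬ refl (trans (sym (fits 0 z≤n)) (trans g≡g′ (fits′ 0 z≤n)))

agreeOutside-pinned : ∀ {G F} r b → AgreeOutside G F → AgreeOutside (Pinned G r b) (F ∖ r)
agreeOutside-pinned r b agree (Gg , gr≡b) (Gg′ , g′r≡b) {p} p∉F∖r with p ≟ r
... | yes refl = trans gr≡b (sym g′r≡b)
... | no p≢r   = agree Gg Gg′ λ p∈F → p∉F∖r (∈-filter⁺ (λ p → ¬? (p ≟ r)) p∈F p≢r)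

length-∖-< : ∀ {r F} → r ∈ F → length (F ∖ r) < length F
length-∖-< {r} {F} r∈F = filter-notAll (λ p → ¬? (p ≟ r)) F (Any.map (λ r≡p p≢r → p≢r (sym r≡p)) r∈F)

agreeOutside⇒¬infiniteLittlestoneTree′ : ∀ {G} x F → Acc _<_ (length F) →
  AgreeOutside G F → ¬ IsInfiniteLittlestoneTree G x
agreeOutside⇒¬infiniteLittlestoneTree′ x F (acc rec) agree T with root x ∈? F
... | yes r∈F = agreeOutside⇒¬infiniteLittlestoneTree′ (subtree x false) (F ∖ root x) (rec (length-∖-< r∈F))
                  (agreeOutside-pinned (root x) false agree)
                  (subtree-isInfiniteLittlestoneTree x false T)
... | no r∉F with _ , _ , Gg , Gg′ , disagree ← root-labels-disagree x T
  = disagree (agree Gg Gg′ r∉F)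

agreeOutside⇒¬infiniteLittlestoneTree : ∀ {G} x F → AgreeOutside G F → ¬ IsInfiniteLittlestoneTree G x
agreeOutside⇒¬infiniteLittlestoneTree x F = agreeOutside⇒¬infiniteLittlestoneTree′ x F (<-wellFounded (length F))

module _ (M : TM) where

  run-halted-mono : ∀ {m n} c → m ≤ n → is-nothing (run M m c) ≡ true → is-nothing (run M n c) ≡ true
  run-halted-mono {suc m} {suc n} c (s≤s m≤n) halted with step M c
  ... | nothing = refl
  ... | just c′ = run-halted-mono c′ m≤n halted

  haltsWithin-mono : ∀ {m n} → m ≤ n → HaltsWithin M m → HaltsWithin M n
  haltsWithin-mono m≤n = run-halted-mono (initial M) m≤n

  h-halted : ∀ {n} a → HaltsWithin M n → h M a n ≡ false
  h-halted a halted rewrite halted = refl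

  h-running : ∀ {n} a → ¬ HaltsWithin M n → h M a n ≡ a n
  h-running {n} a running with haltsWithinᵇ M n
  ... | true  = ⊥-elim (running refl)
  ... | false = refl

  𝓗-agreeOutside-upTo : ∀ {N} → HaltsWithin M N → AgreeOutside (𝓗 M) (upTo N)
  𝓗-agreeOutside-upTo {N} halted (a , _ , g≡ha) (a′ , _ , g′≡ha′) {p} p∉upTo =
    trans (trans (g≡ha p) (h-halted a halted-at-p)) (sym (trans (g′≡ha′ p) (h-halted a′ halted-at-p)))
    where
    halted-at-p : HaltsWithin M p
    halted-at-p = haltsWithin-mono (≮⇒≥ λ p<N → p∉upTo (∈-upTo⁺ p<N)) halted

truncate : (ℕ → Bool) → ℕ → ℕ → Bool
truncate y n k = if k ≤ᵇ n then y k else false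

truncate-finSupp : ∀ y n → FinSupp (truncate y n)
truncate-finSupp y n = suc n , vanishes
  where
  vanishes : ∀ k → suc n ≤ k → truncate y n k ≡ false
  vanishes k n<k with k ≤ᵇ n in k≤ᵇn
  ... | false = refl
  ... | true  = ⊥-elim (<⇒≱ n<k (≤ᵇ⇒≤ k n (Equivalence.from T-≡ k≤ᵇn)))

truncate-≤ : ∀ y {n k} → k ≤ n → truncate y n k ≡ y k
truncate-≤ y {n} {k} k≤n with k ≤ᵇ n | ≤⇒≤ᵇ k≤n
... | true | _ = refl

depthTree-isInfiniteLittlestoneTree : ∀ M → ¬ Halts M → IsInfiniteLittlestoneTree (𝓗 M) depthTree
depthTree-isInfiniteLittlestoneTree M never y n =
  h M a , (a , truncate-finSupp y n , λ _ → refl) , λ k k≤n →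
    trans (h-running M a (λ halted → never (k , halted))) (truncate-≤ y k≤n)
  where
  a : ℕ → Bool
  a = truncate y n

proposition4p11 : (M : TM) →
    (HasInfiniteLittlestoneTree (𝓗 M) → ¬ Halts M) × (¬ Halts M → HasInfiniteLittlestoneTree (𝓗 M))
proposition4p11 M =
  (λ { (x , T) (N , halted) → agreeOutside⇒¬infiniteLittlestoneTree x (upTo N) (𝓗-agreeOutside-upTo M halted) T })
  , λ never → depthTree , depthTree-isInfiniteLittlestoneTree M never
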